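{- The minimum positive integer $n$ for which there exist two distinct $n\times n\times n$ alternating sign hypermatrices $A$ and $B$ with $L(A)=L(B)$ is $n=4$. That is, for $n\le 3$ any two $n\times n\times n$ ASHMs $A,B$ with $L(A)=L(B)$ are equal, and there exist two distinct $4\times4\times4$ ASHMs $A,B$ with $L(A)=L(B)$.
   Context: An $n\times n\times n$ hypermatrix $A=[a_{ijk}]$ has row lines $(a_{ijk})_{i=1}^n$ (fixed $j,k$), column lines $(a_{ijk})_{j=1}^n$ (fixed $i,k$) and vertical lines $(a_{ijk})_{k=1}^n$ (fixed $i,j$); its $k$-th plane is $P_k(A)=[a_{ijk}]_{i,j=1}^n$. An alternating sign hypermatrix (ASHM) is an $n\times n\times n$ $\{0,1,-1\}$-hypermatrix in which the non-zero entries of every row line, column line and vertical line alternate in sign, beginning and ending with $+1$. For an ASHM $A$, its ASHL is the $n\times n$ matrix $L(A)=\sum_{k=1}^n k\,P_k(A)$. -}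

module Defs where

open import Data.Nat using (ℕ; suc)
open import Data.Integer using (ℤ; +_; -_; _*_; _+_; 0ℤ; 1ℤ; -1ℤ)
open import Data.Fin using (Fin; toℕ)
open import Data.List using (List; []; _∷_; filter)
open import Data.Vec.Functional using (Vector; toList)
open import Data.Vec.Functional using () renaming (foldr to vfoldr)
open import Data.Sum using (_⊎_)
open import Relation.Binary.PropositionalEquality using (_≡_)
open import Relation.Nullary using (¬_)
open import Relation.Nullary.Decidable using (¬?)
open import Data.Integer.Properties using (_≟_)

Hypermatrix : ℕ → Set
Hypermatrix n = Fin n → Fin n → Fin n → ℤ

data AltSign : List ℤ → Set where
  one  : AltSign (1ℤ ∷ [])
  step : ∀ {xs} → AltSign xs → AltSign (1ℤ ∷ -1ℤ ∷ xs)

nonzeros : List ℤ → List ℤ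
nonzeros = filter (λ x → ¬? (x ≟ 0ℤ))

AltLine : ∀ {n} → Vector ℤ n → Set
AltLine v = AltSign (nonzeros (toList v))

Trit : ℤ → Set
Trit x = (x ≡ 0ℤ) ⊎ (x ≡ 1ℤ) ⊎ (x ≡ -1ℤ)

record IsASHM {n : ℕ} (A : Hypermatrix n) : Set where
  field
    entries  : ∀ i j k → Trit (A i j k)
    rowLines : ∀ j k → AltLine (λ i → A i j k)
    colLines : ∀ i k → AltLine (λ j → A i j k)
    vertLines : ∀ i j → AltLine (λ k → A i j k)

-- The ASHL L(A) = Σ_{k=1}^n k P_k(A); with 0-based index k the weight is toℕ k + 1.
L : ∀ {n} → Hypermatrix n → Fin n → Fin n → ℤ
L {n} A i j = vfoldr _+_ 0ℤ (λ k → + suc (toℕ k) * A i j k)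

module Submission where

-- Proof idea.  Every alternating line sums to 1, since its non-zero entries
-- read +1, -1, ..., -1, +1.  The ASHL entry L(A)ᵢⱼ is the weight
-- Σₖ (k+1)·aᵢⱼₖ of the vertical line through (i, j).
--
-- * n ≤ 2: a line of length 1 is determined by its sum, one of length 2 by
--   its sum and weight (a linear system), so L(A) = L(B) forces A = B.
-- * n = 3: the alternating {0,±1}-lines of length 3 are exactly
--   (1,0,0), (0,1,0), (0,0,1) and (1,-1,1).  Their weights 1, 2, 3, 2 collide
--   only for (0,1,0) against (1,-1,1), and a -1 in a 3×3×3 ASHM sits at its
--   centre.  Hence the vertical lines of A and B agree off the centre; the
--   row line through the centre of the bottom plane then has the same outer
--   entries in A and B and sum 1 in both, so the central vertical lines have
--   the same first entry; with equal sums and weights they are then equal.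
-- * n = 4: an explicit pair, verified by deciding IsASHM and L(A) = L(B).

open import Defs
open import Data.Nat using (ℕ; suc; _≤_; s≤s)
open import Data.Fin using (toℕ)
open import Data.Fin.Patterns using (0F; 1F; 2F)
open import Data.Fin.Properties using (all?)
open import Data.Integer using (ℤ; +_; _+_; _-_; _*_; 0ℤ; 1ℤ; -1ℤ)
open import Data.Integer.Properties using (_≟_; +-identityˡ; +-identityʳ)
open import Data.Integer.Tactic.RingSolver using (solve-∀)
open import Data.List using (List; []; _∷_; foldr)
open import Data.Vec using (Vec; []; _∷_; lookup)
open import Data.Vec.Functional using (Vector; toList) renaming (foldr to vfoldr)
open import Data.Vec.Functional.Relation.Binary.Pointwise.Properties using (foldr-cong)
open import Data.Product using (_×_; Σ; Σ-syntax; _,_)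
open import Data.Sum using (_⊎_; inj₁; inj₂)
open import Data.Empty using (⊥-elim)
open import Data.Unit using (tt)
open import Relation.Binary.PropositionalEquality using (_≡_; _≢_; refl; sym; trans; cong; cong₂)
open import Relation.Nullary using (¬_; Dec; yes; no)
open import Relation.Nullary.Decidable using (map′; toWitness; _×-dec_; _⊎-dec_)

open IsASHM

listSum : List ℤ → ℤ
listSum = foldr _+_ 0ℤ

lineSum : ∀ {n} → Vector ℤ n → ℤ
lineSum v = listSum (toList v)

weight : ∀ {n} → Vector ℤ n → ℤ
weight v = vfoldr _+_ 0ℤ (λ k → + suc (toℕ k) * v k)

weight-cong : ∀ {n} {v w : Vector ℤ n} → (∀ k → v k ≡ w k) → weight v ≡ weight w
weight-cong v≡w =
  foldr-cong {R = _≡_} {S = _≡_} (cong₂ _+_) refl (λ k → cong (+ suc (toℕ k) *_) (v≡w k))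

altSign-sum : ∀ {xs} → AltSign xs → listSum xs ≡ 1ℤ
altSign-sum one         = refl
altSign-sum (step alts) rewrite altSign-sum alts = refl

nonzeros-sum : (xs : List ℤ) → listSum (nonzeros xs) ≡ listSum xs
nonzeros-sum []       = refl
nonzeros-sum (x ∷ xs) with x ≟ 0ℤ
... | yes refl = trans (nonzeros-sum xs) (sym (+-identityˡ (listSum xs)))
... | no  _    = cong (_+_ x) (nonzeros-sum xs)

altLine-sum : ∀ {n} (v : Vector ℤ n) → AltLine v → lineSum v ≡ 1ℤ
altLine-sum v alt = trans (sym (nonzeros-sum (toList v))) (altSign-sum alt)

vertical-sums-agree : ∀ {n} {A B : Hypermatrix n} → IsASHM A → IsASHM B →
                      ∀ i j → lineSum (A i j) ≡ lineSum (B i j)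
vertical-sums-agree {A = A} {B} isA isB i j =
  trans (altLine-sum (A i j) (vertLines isA i j)) (sym (altLine-sum (B i j) (vertLines isB i j)))

determined₁ : (v w : Vector ℤ 1) → lineSum v ≡ lineSum w → ∀ k → v k ≡ w k
determined₁ v w sums 0F = trans (sym (+-identityʳ (v 0F))) (trans sums (+-identityʳ (w 0F)))

determined₂ : (v w : Vector ℤ 2) → lineSum v ≡ lineSum w → weight v ≡ weight w →
              ∀ k → v k ≡ w k
determined₂ v w sums weights = entry
  where
  -- the second entry is weight minus sum, the first is sum minus second
  second : ∀ x y → y ≡ (+ 1 * x + (+ 2 * y + 0ℤ)) - (x + (y + 0ℤ))
  second = solve-∀
  first : ∀ x y → x ≡ (x + (y + 0ℤ)) - y
  first = solve-∀
  entry₁ : v 1F ≡ w 1F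
  entry₁ = trans (second (v 0F) (v 1F)) (trans (cong₂ _-_ weights sums) (sym (second (w 0F) (w 1F))))
  entry : ∀ k → v k ≡ w k
  entry 0F = trans (first (v 0F) (v 1F)) (trans (cong₂ _-_ sums entry₁) (sym (first (w 0F) (w 1F))))
  entry 1F = entry₁

data Line3 : Set where
  unit₀ unit₁ unit₂ zigzag : Line3

line3 : Line3 → Vector ℤ 3
line3 unit₀  = λ { 0F → 1ℤ ; 1F → 0ℤ  ; 2F → 0ℤ }
line3 unit₁  = λ { 0F → 0ℤ ; 1F → 1ℤ  ; 2F → 0ℤ }
line3 unit₂  = λ { 0F → 0ℤ ; 1F → 0ℤ  ; 2F → 1ℤ }
line3 zigzag = λ { 0F → 1ℤ ; 1F → -1ℤ ; 2F → 1ℤ }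

classify3 : ∀ x y z → Trit x → Trit y → Trit z → AltSign (nonzeros (x ∷ y ∷ z ∷ [])) →
            Σ Line3 λ p → x ≡ line3 p 0F × y ≡ line3 p 1F × z ≡ line3 p 2F
classify3 _ _ _ (inj₁ refl)        (inj₁ refl)        (inj₁ refl)        ()
classify3 _ _ _ (inj₁ refl)        (inj₁ refl)        (inj₂ (inj₁ refl)) _ = unit₂ , refl , refl , refl
classify3 _ _ _ (inj₁ refl)        (inj₁ refl)        (inj₂ (inj₂ refl)) ()
classify3 _ _ _ (inj₁ refl)        (inj₂ (inj₁ refl)) (inj₁ refl)        _ = unit₁ , refl , refl , refl
classify3 _ _ _ (inj₁ refl)        (inj₂ (inj₁ refl)) (inj₂ (inj₁ refl)) ()
classify3 _ _ _ (inj₁ refl)        (inj₂ (inj₁ refl)) (inj₂ (inj₂ refl)) (step ())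
classify3 _ _ _ (inj₁ refl)        (inj₂ (inj₂ refl)) _                  ()
classify3 _ _ _ (inj₂ (inj₁ refl)) (inj₁ refl)        (inj₁ refl)        _ = unit₀ , refl , refl , refl
classify3 _ _ _ (inj₂ (inj₁ refl)) (inj₁ refl)        (inj₂ (inj₁ refl)) ()
classify3 _ _ _ (inj₂ (inj₁ refl)) (inj₁ refl)        (inj₂ (inj₂ refl)) (step ())
classify3 _ _ _ (inj₂ (inj₁ refl)) (inj₂ (inj₁ refl)) _                  ()
classify3 _ _ _ (inj₂ (inj₁ refl)) (inj₂ (inj₂ refl)) (inj₁ refl)        (step ())
classify3 _ _ _ (inj₂ (inj₁ refl)) (inj₂ (inj₂ refl)) (inj₂ (inj₁ refl)) _ = zigzag , refl , refl , refl
classify3 _ _ _ (inj₂ (inj₁ refl)) (inj₂ (inj₂ refl)) (inj₂ (inj₂ refl)) (step ())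
classify3 _ _ _ (inj₂ (inj₂ refl)) _                  _                  ()

line3-pattern : (v : Vector ℤ 3) → (∀ k → Trit (v k)) → AltLine v →
                Σ Line3 λ p → ∀ k → v k ≡ line3 p k
line3-pattern v trit alt with classify3 (v 0F) (v 1F) (v 2F) (trit 0F) (trit 1F) (trit 2F) alt
... | p , e₀ , e₁ , e₂ = p , λ { 0F → e₀ ; 1F → e₁ ; 2F → e₂ }

line3-minus : ∀ p k → line3 p k ≡ -1ℤ → k ≡ 1F
line3-minus zigzag 1F _  = refl
line3-minus zigzag 0F ()
line3-minus zigzag 2F ()
line3-minus unit₀  0F ()
line3-minus unit₀  1F ()
line3-minus unit₀  2F ()
line3-minus unit₁  0F ()
line3-minus unit₁  1F ()
line3-minus unit₁  2F ()
line3-minus unit₂  0F ()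
line3-minus unit₂  1F ()
line3-minus unit₂  2F ()

minus-in-middle : (v : Vector ℤ 3) → (∀ k → Trit (v k)) → AltLine v →
                  ∀ k → v k ≡ -1ℤ → k ≡ 1F
minus-in-middle v trit alt k vₖ≡-1 with line3-pattern v trit alt
... | p , v≡p = line3-minus p k (trans (sym (v≡p k)) vₖ≡-1)

-- In a 3×3×3 ASHM every -1 lies on the central vertical line, since it lies
-- in the middle of its row line and of its column line.
minus-at-centre : ∀ {C : Hypermatrix 3} → IsASHM C → ∀ i j k → C i j k ≡ -1ℤ → i ≡ 1F × j ≡ 1F
minus-at-centre {C} isC i j k minus =
    minus-in-middle (λ i′ → C i′ j k) (λ i′ → entries isC i′ j k) (rowLines isC j k) i minus
  , minus-in-middle (λ j′ → C i j′ k) (λ j′ → entries isC i j′ k) (colLines isC i k) j minus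

-- The weights 1, 2, 3, 2 of the patterns collide only between (0,1,0) and
-- (1,-1,1), and in that case one of the two lines has a -1 in the middle.
weight-collision : ∀ p q → weight (line3 p) ≡ weight (line3 q) →
                   p ≡ q ⊎ line3 p 1F ≡ -1ℤ ⊎ line3 q 1F ≡ -1ℤ
weight-collision zigzag _      _  = inj₂ (inj₁ refl)
weight-collision _      zigzag _  = inj₂ (inj₂ refl)
weight-collision unit₀  unit₀  _  = inj₁ refl
weight-collision unit₁  unit₁  _  = inj₁ refl
weight-collision unit₂  unit₂  _  = inj₁ refl
weight-collision unit₀  unit₁  ()
weight-collision unit₀  unit₂  ()
weight-collision unit₁  unit₀  ()
weight-collision unit₁  unit₂  ()
weight-collision unit₂  unit₀  ()
weight-collision unit₂  unit₁  ()

-- Three linear conditions determine a line of length 3: sum, weight and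
-- first entry (solving for the third, then the second entry).
determined₃ : (v w : Vector ℤ 3) → lineSum v ≡ lineSum w → weight v ≡ weight w →
              v 0F ≡ w 0F → ∀ k → v k ≡ w k
determined₃ v w sums weights firsts = entry
  where
  third : ∀ x y z → z ≡ ((+ 1 * x + (+ 2 * y + (+ 3 * z + 0ℤ))) - (x + (y + (z + 0ℤ))))
                         - ((x + (y + (z + 0ℤ))) - x)
  third = solve-∀
  second : ∀ x y z → y ≡ ((x + (y + (z + 0ℤ))) - x) - z
  second = solve-∀
  entry₂ : v 2F ≡ w 2F
  entry₂ = trans (third (v 0F) (v 1F) (v 2F))
                 (trans (cong₂ _-_ (cong₂ _-_ weights sums) (cong₂ _-_ sums firsts))
                        (sym (third (w 0F) (w 1F) (w 2F))))
  entry : ∀ k → v k ≡ w k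
  entry 0F = firsts
  entry 1F = trans (second (v 0F) (v 1F) (v 2F))
                   (trans (cong₂ _-_ (cong₂ _-_ sums firsts) entry₂) (sym (second (w 0F) (w 1F) (w 2F))))
  entry 2F = entry₂

determined-middle : (v w : Vector ℤ 3) → lineSum v ≡ lineSum w →
                    v 0F ≡ w 0F → v 2F ≡ w 2F → v 1F ≡ w 1F
determined-middle v w sums firsts thirds =
  trans (middle (v 0F) (v 1F) (v 2F))
        (trans (cong₂ _-_ sums (cong₂ _+_ firsts thirds)) (sym (middle (w 0F) (w 1F) (w 2F))))
  where
  middle : ∀ x y z → y ≡ (x + (y + (z + 0ℤ))) - (x + z)
  middle = solve-∀

module Order3 {A B : Hypermatrix 3} (isA : IsASHM A) (isB : IsASHM B)
              (sameL : ∀ i j → L A i j ≡ L B i j) where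

  agree-or-centre : ∀ i j → (∀ k → A i j k ≡ B i j k) ⊎ (i ≡ 1F × j ≡ 1F)
  agree-or-centre i j
    with line3-pattern (A i j) (entries isA i j) (vertLines isA i j)
       | line3-pattern (B i j) (entries isB i j) (vertLines isB i j)
  ... | p , A≡p | q , B≡q
    with weight-collision p q (trans (sym (weight-cong A≡p)) (trans (sameL i j) (weight-cong B≡q)))
  ... | inj₁ refl        = inj₁ λ k → trans (A≡p k) (sym (B≡q k))
  ... | inj₂ (inj₁ minus) = inj₂ (minus-at-centre isA i j 1F (trans (A≡p 1F) minus))
  ... | inj₂ (inj₂ minus) = inj₂ (minus-at-centre isB i j 1F (trans (B≡q 1F) minus))

  agree-off-centre : ∀ i j → i ≢ 1F → ∀ k → A i j k ≡ B i j k
  agree-off-centre i j i≢1 with agree-or-centre i j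
  ... | inj₁ same        = same
  ... | inj₂ (i≡1 , _)   = ⊥-elim (i≢1 i≡1)

  -- The row line through the centre of the bottom plane has equal outer
  -- entries in A and B and sum 1 in both, hence equal middle entries.
  centre-bottom : A 1F 1F 0F ≡ B 1F 1F 0F
  centre-bottom =
    determined-middle (λ i → A i 1F 0F) (λ i → B i 1F 0F)
      (trans (altLine-sum (λ i → A i 1F 0F) (rowLines isA 1F 0F))
             (sym (altLine-sum (λ i → B i 1F 0F) (rowLines isB 1F 0F))))
      (agree-off-centre 0F 1F (λ ()) 0F) (agree-off-centre 2F 1F (λ ()) 0F)

  equal : ∀ i j k → A i j k ≡ B i j k
  equal i j with agree-or-centre i j
  ... | inj₁ same          = same
  ... | inj₂ (refl , refl) =
    determined₃ (A 1F 1F) (B 1F 1F) (vertical-sums-agree isA isB 1F 1F) (sameL 1F 1F) centre-bottom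

uniqueness : (n : ℕ) → n ≤ 3 → (A B : Hypermatrix n) → IsASHM A → IsASHM B →
             (∀ i j → L A i j ≡ L B i j) → ∀ i j k → A i j k ≡ B i j k
uniqueness 0 _ A B isA isB sameL ()
uniqueness 1 _ A B isA isB sameL i j =
  determined₁ (A i j) (B i j) (vertical-sums-agree isA isB i j)
uniqueness 2 _ A B isA isB sameL i j =
  determined₂ (A i j) (B i j) (vertical-sums-agree isA isB i j) (sameL i j)
uniqueness 3 _ A B isA isB sameL = Order3.equal isA isB sameL
uniqueness (suc (suc (suc (suc _)))) (s≤s (s≤s (s≤s ())))

altSign? : (xs : List ℤ) → Dec (AltSign xs)
altSign? []           = no λ ()
altSign? (x ∷ [])     with x ≟ 1ℤ
... | yes refl = yes one
... | no  x≢1  = no λ { one → x≢1 refl }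
altSign? (x ∷ y ∷ xs) with x ≟ 1ℤ | y ≟ -1ℤ | altSign? xs
... | yes refl | yes refl | yes alt = yes (step alt)
... | no  x≢1  | _        | _       = no λ { (step _) → x≢1 refl }
... | _        | no  y≢-1 | _       = no λ { (step _) → y≢-1 refl }
... | _        | _        | no ¬alt = no λ { (step alt) → ¬alt alt }

trit? : (x : ℤ) → Dec (Trit x)
trit? x = x ≟ 0ℤ ⊎-dec x ≟ 1ℤ ⊎-dec x ≟ -1ℤ

isASHM? : ∀ {n} (A : Hypermatrix n) → Dec (IsASHM A)
isASHM? A =
  map′ (λ (e , r , c , v) → record { entries = e ; rowLines = r ; colLines = c ; vertLines = v })
       (λ isA → entries isA , rowLines isA , colLines isA , vertLines isA)
       (   (all? λ i → all? λ j → all? λ k → trit? (A i j k))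
    ×-dec (all? λ j → all? λ k → altSign? (nonzeros (toList (λ i → A i j k))))
    ×-dec (all? λ i → all? λ k → altSign? (nonzeros (toList (λ j → A i j k))))
    ×-dec (all? λ i → all? λ j → altSign? (nonzeros (toList (λ k → A i j k)))))

-- A hypermatrix given by its planes P₀, P₁, …, each listed row by row.
fromPlanes : ∀ {n} → Vec (Vec (Vec ℤ n) n) n → Hypermatrix n
fromPlanes planes i j k = lookup (lookup (lookup planes k) i) j

-- Two 4×4×4 ASHMs with the same ASHL.  They differ exactly on the four
-- central vertical lines, e.g. (0,1,0,0) in A against (1,0,-1,1) in B, and
-- corresponding vertical lines have equal weights.
exampleA : Hypermatrix 4
exampleA = fromPlanes
  ( ( (0ℤ ∷ 0ℤ ∷ 0ℤ ∷ 1ℤ ∷ []) ∷ (0ℤ ∷ 0ℤ ∷ 1ℤ ∷ 0ℤ ∷ []) ∷ (0ℤ ∷ 1ℤ ∷ 0ℤ ∷ 0ℤ ∷ []) ∷ (1ℤ ∷ 0ℤ ∷ 0ℤ ∷ 0ℤ ∷ []) ∷ [])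
  ∷ ( (0ℤ ∷ 0ℤ ∷ 1ℤ ∷ 0ℤ ∷ []) ∷ (0ℤ ∷ 1ℤ ∷ -1ℤ ∷ 1ℤ ∷ []) ∷ (1ℤ ∷ -1ℤ ∷ 1ℤ ∷ 0ℤ ∷ []) ∷ (0ℤ ∷ 1ℤ ∷ 0ℤ ∷ 0ℤ ∷ []) ∷ [])
  ∷ ( (0ℤ ∷ 1ℤ ∷ 0ℤ ∷ 0ℤ ∷ []) ∷ (1ℤ ∷ 0ℤ ∷ 0ℤ ∷ 0ℤ ∷ []) ∷ (0ℤ ∷ 0ℤ ∷ 0ℤ ∷ 1ℤ ∷ []) ∷ (0ℤ ∷ 0ℤ ∷ 1ℤ ∷ 0ℤ ∷ []) ∷ [])
  ∷ ( (1ℤ ∷ 0ℤ ∷ 0ℤ ∷ 0ℤ ∷ []) ∷ (0ℤ ∷ 0ℤ ∷ 1ℤ ∷ 0ℤ ∷ []) ∷ (0ℤ ∷ 1ℤ ∷ 0ℤ ∷ 0ℤ ∷ []) ∷ (0ℤ ∷ 0ℤ ∷ 0ℤ ∷ 1ℤ ∷ []) ∷ [])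
  ∷ [])

exampleB : Hypermatrix 4
exampleB = fromPlanes
  ( ( (0ℤ ∷ 0ℤ ∷ 0ℤ ∷ 1ℤ ∷ []) ∷ (0ℤ ∷ 1ℤ ∷ 0ℤ ∷ 0ℤ ∷ []) ∷ (0ℤ ∷ 0ℤ ∷ 1ℤ ∷ 0ℤ ∷ []) ∷ (1ℤ ∷ 0ℤ ∷ 0ℤ ∷ 0ℤ ∷ []) ∷ [])
  ∷ ( (0ℤ ∷ 0ℤ ∷ 1ℤ ∷ 0ℤ ∷ []) ∷ (0ℤ ∷ 0ℤ ∷ 0ℤ ∷ 1ℤ ∷ []) ∷ (1ℤ ∷ 0ℤ ∷ 0ℤ ∷ 0ℤ ∷ []) ∷ (0ℤ ∷ 1ℤ ∷ 0ℤ ∷ 0ℤ ∷ []) ∷ [])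
  ∷ ( (0ℤ ∷ 1ℤ ∷ 0ℤ ∷ 0ℤ ∷ []) ∷ (1ℤ ∷ -1ℤ ∷ 1ℤ ∷ 0ℤ ∷ []) ∷ (0ℤ ∷ 1ℤ ∷ -1ℤ ∷ 1ℤ ∷ []) ∷ (0ℤ ∷ 0ℤ ∷ 1ℤ ∷ 0ℤ ∷ []) ∷ [])
  ∷ ( (1ℤ ∷ 0ℤ ∷ 0ℤ ∷ 0ℤ ∷ []) ∷ (0ℤ ∷ 1ℤ ∷ 0ℤ ∷ 0ℤ ∷ []) ∷ (0ℤ ∷ 0ℤ ∷ 1ℤ ∷ 0ℤ ∷ []) ∷ (0ℤ ∷ 0ℤ ∷ 0ℤ ∷ 1ℤ ∷ []) ∷ [])
  ∷ [])

counterexample : Σ[ A ∈ Hypermatrix 4 ] Σ[ B ∈ Hypermatrix 4 ]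
                 (IsASHM A × IsASHM B × (∀ i j → L A i j ≡ L B i j) × ¬ (∀ i j k → A i j k ≡ B i j k))
counterexample =
    exampleA , exampleB
  , toWitness {a? = isASHM? exampleA} tt
  , toWitness {a? = isASHM? exampleB} tt
  , toWitness {a? = all? λ i → all? λ j → L exampleA i j ≟ L exampleB i j} tt
  , λ same → 0≢1 (same 1F 1F 0F)
  where
  0≢1 : 0ℤ ≢ 1ℤ
  0≢1 ()

theorem15 : ((n : ℕ) → n ≤ 3 → (A B : Hypermatrix n) → IsASHM A → IsASHM B →
    (∀ i j → L A i j ≡ L B i j) → ∀ i j k → A i j k ≡ B i j k)
    × (Σ[ A ∈ Hypermatrix 4 ] Σ[ B ∈ Hypermatrix 4 ]
    (IsASHM A × IsASHM B × (∀ i j → L A i j ≡ L B i j) × ¬ (∀ i j k → A i j k ≡ B i j k)))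
theorem15 = uniqueness , counterexample
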